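{- Let $p\ge 7$ be a prime. Then $$\sum_{1\le i<j< k\le p-1}\frac{1}{i^2jk}\equiv\sum_{1\le i<j< k\le p-1}\frac{1}{ijk^2}\equiv -\frac{1}{2}\sum_{1\le i<j< k\le p-1}\frac{1}{ij^2k}\pmod{p}.$$
   Context: Congruences modulo $p$ are taken in the ring of rational numbers with denominators not divisible by $p$. -}

module Defs where

open import Data.Nat as ℕ using (ℕ; zero; suc; _<ᵇ_; _∸_)
open import Data.Nat.Divisibility using (_∣_)
open import Data.Integer as ℤ using (+_)
open import Data.Rational using (ℚ; _/_; _+_; _*_; _-_; 0ℚ; ↥_; ↧ₙ_)
open import Data.List using (List; foldr; concatMap; applyUpTo)
open import Data.Bool using (if_then_else_; _∧_)
open import Data.Product using (_×_)
open import Relation.Nullary using (¬_)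

-- multiplicative inverse of a positive natural number as a rational
-- (inv 0 is set to 0, but it is never used below: all arguments are ≥ 1)
inv : ℕ → ℚ
inv zero    = 0ℚ
inv (suc n) = + 1 / suc n

sumℚ : List ℚ → ℚ
sumℚ = foldr _+_ 0ℚ

range1 : ℕ → List ℕ
range1 n = applyUpTo suc n

tripleSum : ℕ → (ℕ → ℕ → ℕ → ℚ) → ℚ
tripleSum p f =
  sumℚ (concatMap (λ i → concatMap (λ j → Data.List.map (λ k →
      if (i <ᵇ j) ∧ (j <ᵇ k) then f i j k else 0ℚ)
    (range1 (p ∸ 1))) (range1 (p ∸ 1))) (range1 (p ∸ 1)))

-- congruence modulo p in the ring Z_(p) of rationals whose denominator is
-- not divisible by p: a ≡ b (mod p) iff a, b ∈ Z_(p) and (a - b) ∈ p Z_(p),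
-- i.e. for reduced fractions: p ∤ den a, p ∤ den b, p ∣ num (a - b).
_≡_[modℚ_] : ℚ → ℚ → ℕ → Set
a ≡ b [modℚ p ] =
  ¬ (p ∣ ↧ₙ a) × ¬ (p ∣ ↧ₙ b) × (p ∣ ℤ.∣ ↥ (a - b) ∣)

-- Let xs = 1, 1/2, …, 1/(p − 1) and H_abc = ∑_{i<j<k} x_i^a x_j^b x_k^c. Since 1/(p − t) ≡ −1/t,
-- reversing xs agrees mod p with negating it; reversal turns H₂₁₁ into H₁₁₂ and negation fixes
-- both, so H₂₁₁ ≡ H₁₁₂. Newton's identity gives H₂₁₁ + H₁₂₁ + H₁₁₂ = P₂E₂ − P₃P₁ + P₄ in terms of
-- the power sums P_k and E₂ = ∑_{i<j} x_i x_j. Writing every t < p as 2s or as t + p = 2s shows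
-- P_k ≡ 2⁻ᵏ P_k, so P_k ≡ 0 when p ∤ 2ᵏ − 1, which holds for k = 1, 2, 4 when p ≥ 7.
-- Hence 2H₁₁₂ + H₁₂₁ ≡ 0.

module Submission where

open import Algebra.Bundles using (CommutativeMonoid)
open import Data.Bool using (T; false; if_then_else_; _∧_)
open import Data.Bool.Properties using (∧-zeroʳ; T-≡; ¬-not)
open import Data.Empty using (⊥-elim)
import Data.Integer as ℤ
import Data.Integer.Properties as ℤ
open import Data.Integer.Divisibility.Signed using (∣ᵤ⇒∣; ∣⇒∣ᵤ; ∣m∣n⇒∣m+n; ∣m⇒∣m*n; ∣m⇒∣-m) renaming (_∣_ to _∣ℤ_; ∣-refl to ℤ∣-refl)
open import Data.Integer.Solver using () renaming (module +-*-Solver to ℤS)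
open import Data.List using (List; []; _∷_; _∷ʳ_; _++_; map; concatMap; applyUpTo; applyDownFrom; reverse)
import Data.List.Properties as List
open import Data.List.Relation.Binary.Pointwise using (Pointwise; []; _∷_)
open import Data.List.Relation.Unary.All using (All; []; _∷_)
open import Data.List.Relation.Unary.AllPairs using (AllPairs; []; _∷_)
import Data.List.Relation.Unary.AllPairs.Properties as AllPairs
open import Data.Nat as ℕ using (ℕ; zero; suc; _∸_; _*_; _<ᵇ_; _≤_; _<_; _^_; z≤n; s≤s; z<s; NonZero)
import Data.Nat.Properties as ℕ
import Data.Nat.DivMod as DivMod
open import Data.Nat.Divisibility using (_∣_; divides; ∣-trans; _∣0; ∣1⇒≡1; ∣-reflexive; >⇒∤; m%n≡0⇒n∣m; ∣m+n∣m⇒∣n)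
open import Data.Nat.GCD using (gcd; gcd[m,n]∣n)
open import Data.Nat.Primality using (Prime; euclidsLemma; ¬prime[1]; prime⇒irreducible)
open import Data.Nat.Solver using () renaming (module +-*-Solver to ℕS)
open import Data.Product using (_×_; _,_; ∃-syntax)
open import Data.Rational as ℚ using (ℚ; _+_; -_; _-_; _/_; 0ℚ; 1ℚ; ½; ↥_; ↧_; ↧ₙ_) renaming (_*_ to _·_)
open import Data.Rational using () renaming (_*_ to _*ℚ_)
import Data.Rational.Properties as ℚ
open import Data.Rational.Solver using (module +-*-Solver)
import Data.Rational.Unnormalised as ℚᵘ
import Data.Rational.Unnormalised.Properties as ℚᵘ
open import Data.Sum using ([_,_]′)
open import Function using (_∘_; flip; id)
open import Function.Bundles using (Equivalence)
open import Relation.Binary.Bundles using (PartialSetoid)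
open import Relation.Binary.PropositionalEquality
import Relation.Binary.Reasoning.PartialSetoid as PartialSetoidReasoning
open import Relation.Nullary using (¬_)

open import Defs

open +-*-Solver using (solve; con; _:+_; _:*_; _:-_; :-_; _:=_)
open import Algebra.Properties.CommutativeSemigroup (CommutativeMonoid.commutativeSemigroup ℚ.+-0-commutativeMonoid)
  using () renaming (interchange to +-interchange)

-- inv 0 = 0 makes inv multiplicative on all of ℕ.
inv-· : ∀ m n → inv (m * n) ≡ inv m · inv n
inv-· zero    n       = sym (ℚ.*-zeroˡ (inv n))
inv-· (suc m) zero    = trans (cong inv (ℕ.*-zeroʳ (suc m))) (sym (ℚ.*-zeroʳ (inv (suc m))))
inv-· (suc m) (suc n) = ℚ.toℚᵘ-injective (ℚᵘ.≃-trans (inv≃ (n ℕ.+ m * suc n))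
  (ℚᵘ.≃-sym (ℚᵘ.≃-trans (ℚ.toℚᵘ-homo-* (inv (suc m)) (inv (suc n))) (ℚᵘ.*-cong (inv≃ m) (inv≃ n)))))
  where
  inv≃ : ∀ k → ℚ.toℚᵘ (inv (suc k)) ℚᵘ.≃ ℚᵘ.mkℚᵘ (ℤ.+ 1) k
  inv≃ k = ℚ.toℚᵘ-fromℚᵘ (ℚᵘ.mkℚᵘ (ℤ.+ 1) k)

inv-² : ∀ n → inv (n ^ 2) ≡ inv n · inv n
inv-² n = trans (inv-· n (n * 1)) (cong (λ m → inv n · inv m) (ℕ.*-identityʳ n))

module _ {A : Set} where

  open ≡-Reasoning

  Σ₁ : (A → ℚ) → List A → ℚ
  Σ₁ f xs = sumℚ (map f xs)

  Σ₂ : (A → A → ℚ) → List A → ℚ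
  Σ₂ f []       = 0ℚ
  Σ₂ f (x ∷ xs) = Σ₁ (f x) xs + Σ₂ f xs

  Σ₃ : (A → A → A → ℚ) → List A → ℚ
  Σ₃ f []       = 0ℚ
  Σ₃ f (x ∷ xs) = Σ₂ (f x) xs + Σ₃ f xs

  Σ₁-cong : ∀ {f g : A → ℚ} → (∀ x → f x ≡ g x) → ∀ xs → Σ₁ f xs ≡ Σ₁ g xs
  Σ₁-cong f≗g xs = cong sumℚ (List.map-cong f≗g xs)

  Σ₂-cong : ∀ {f g : A → A → ℚ} → (∀ x y → f x y ≡ g x y) → ∀ xs → Σ₂ f xs ≡ Σ₂ g xs
  Σ₂-cong f≗g []       = refl
  Σ₂-cong f≗g (x ∷ xs) = cong₂ _+_ (Σ₁-cong (f≗g x) xs) (Σ₂-cong f≗g xs)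

  Σ₃-cong : ∀ {f g : A → A → A → ℚ} → (∀ x y z → f x y z ≡ g x y z) → ∀ xs → Σ₃ f xs ≡ Σ₃ g xs
  Σ₃-cong f≗g []       = refl
  Σ₃-cong f≗g (x ∷ xs) = cong₂ _+_ (Σ₂-cong (f≗g x) xs) (Σ₃-cong f≗g xs)

  Σ₁-cong-All : ∀ {P : A → Set} {f g : A → ℚ} → (∀ {x} → P x → f x ≡ g x) → ∀ {xs} → All P xs → Σ₁ f xs ≡ Σ₁ g xs
  Σ₁-cong-All f≗g []         = refl
  Σ₁-cong-All f≗g (px ∷ pxs) = cong₂ _+_ (f≗g px) (Σ₁-cong-All f≗g pxs)

  Σ₁-·ˡ : ∀ c (f : A → ℚ) xs → Σ₁ (λ x → c · f x) xs ≡ c · Σ₁ f xs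
  Σ₁-·ˡ c f []       = sym (ℚ.*-zeroʳ c)
  Σ₁-·ˡ c f (x ∷ xs) = trans (cong (c · f x +_) (Σ₁-·ˡ c f xs)) (sym (ℚ.*-distribˡ-+ c (f x) (Σ₁ f xs)))

  Σ₂-·ˡ : ∀ c (f : A → A → ℚ) xs → Σ₂ (λ x y → c · f x y) xs ≡ c · Σ₂ f xs
  Σ₂-·ˡ c f []       = sym (ℚ.*-zeroʳ c)
  Σ₂-·ˡ c f (x ∷ xs) = trans (cong₂ _+_ (Σ₁-·ˡ c (f x) xs) (Σ₂-·ˡ c f xs)) (sym (ℚ.*-distribˡ-+ c _ _))

  Σ₁-∷ʳ : ∀ (f : A → ℚ) xs y → Σ₁ f (xs ∷ʳ y) ≡ Σ₁ f xs + f y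
  Σ₁-∷ʳ f []       y = trans (ℚ.+-identityʳ (f y)) (sym (ℚ.+-identityˡ (f y)))
  Σ₁-∷ʳ f (x ∷ xs) y = trans (cong (f x +_) (Σ₁-∷ʳ f xs y)) (sym (ℚ.+-assoc (f x) _ _))

  Σ₂-∷ʳ : ∀ (f : A → A → ℚ) xs y → Σ₂ f (xs ∷ʳ y) ≡ Σ₂ f xs + Σ₁ (λ x → f x y) xs
  Σ₂-∷ʳ f []       y = ℚ.+-identityʳ 0ℚ
  Σ₂-∷ʳ f (x ∷ xs) y = begin
    Σ₁ (f x) (xs ∷ʳ y) + Σ₂ f (xs ∷ʳ y)                  ≡⟨ cong₂ _+_ (Σ₁-∷ʳ (f x) xs y) (Σ₂-∷ʳ f xs y) ⟩
    (Σ₁ (f x) xs + f x y) + (Σ₂ f xs + Σ₁ (λ x → f x y) xs) ≡⟨ +-interchange (Σ₁ (f x) xs) (f x y) (Σ₂ f xs) _ ⟩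
    (Σ₁ (f x) xs + Σ₂ f xs) + (f x y + Σ₁ (λ x → f x y) xs) ∎

  Σ₃-∷ʳ : ∀ (f : A → A → A → ℚ) xs y → Σ₃ f (xs ∷ʳ y) ≡ Σ₃ f xs + Σ₂ (λ x x′ → f x x′ y) xs
  Σ₃-∷ʳ f []       y = ℚ.+-identityʳ 0ℚ
  Σ₃-∷ʳ f (x ∷ xs) y = begin
    Σ₂ (f x) (xs ∷ʳ y) + Σ₃ f (xs ∷ʳ y)                           ≡⟨ cong₂ _+_ (Σ₂-∷ʳ (f x) xs y) (Σ₃-∷ʳ f xs y) ⟩
    (Σ₂ (f x) xs + Σ₁ (λ x′ → f x x′ y) xs) + (Σ₃ f xs + Σ₂ g xs) ≡⟨ +-interchange (Σ₂ (f x) xs) _ (Σ₃ f xs) _ ⟩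
    (Σ₂ (f x) xs + Σ₃ f xs) + (Σ₁ (λ x′ → f x x′ y) xs + Σ₂ g xs) ∎
    where g = λ x x′ → f x x′ y

  Σ₁-reverse : ∀ (f : A → ℚ) xs → Σ₁ f (reverse xs) ≡ Σ₁ f xs
  Σ₁-reverse f []       = refl
  Σ₁-reverse f (x ∷ xs) = begin
    Σ₁ f (reverse (x ∷ xs))   ≡⟨ cong (Σ₁ f) (List.unfold-reverse x xs) ⟩
    Σ₁ f (reverse xs ∷ʳ x)    ≡⟨ Σ₁-∷ʳ f (reverse xs) x ⟩
    Σ₁ f (reverse xs) + f x   ≡⟨ cong (_+ f x) (Σ₁-reverse f xs) ⟩
    Σ₁ f xs + f x             ≡⟨ ℚ.+-comm (Σ₁ f xs) (f x) ⟩
    f x + Σ₁ f xs             ∎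

  Σ₂-reverse : ∀ (f : A → A → ℚ) xs → Σ₂ f (reverse xs) ≡ Σ₂ (flip f) xs
  Σ₂-reverse f []       = refl
  Σ₂-reverse f (x ∷ xs) = begin
    Σ₂ f (reverse (x ∷ xs))                        ≡⟨ cong (Σ₂ f) (List.unfold-reverse x xs) ⟩
    Σ₂ f (reverse xs ∷ʳ x)                         ≡⟨ Σ₂-∷ʳ f (reverse xs) x ⟩
    Σ₂ f (reverse xs) + Σ₁ (flip f x) (reverse xs) ≡⟨ cong₂ _+_ (Σ₂-reverse f xs) (Σ₁-reverse (flip f x) xs) ⟩
    Σ₂ (flip f) xs + Σ₁ (flip f x) xs              ≡⟨ ℚ.+-comm (Σ₂ (flip f) xs) _ ⟩
    Σ₁ (flip f x) xs + Σ₂ (flip f) xs              ∎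

  Σ₃-reverse : ∀ (f : A → A → A → ℚ) xs → Σ₃ f (reverse xs) ≡ Σ₃ (λ x y z → f z y x) xs
  Σ₃-reverse f []       = refl
  Σ₃-reverse f (x ∷ xs) = begin
    Σ₃ f (reverse (x ∷ xs))                                ≡⟨ cong (Σ₃ f) (List.unfold-reverse x xs) ⟩
    Σ₃ f (reverse xs ∷ʳ x)                                 ≡⟨ Σ₃-∷ʳ f (reverse xs) x ⟩
    Σ₃ f (reverse xs) + Σ₂ (λ y z → f y z x) (reverse xs)  ≡⟨ cong₂ _+_ (Σ₃-reverse f xs) (Σ₂-reverse (λ y z → f y z x) xs) ⟩
    Σ₃ f′ xs + Σ₂ (f′ x) xs                                ≡⟨ ℚ.+-comm (Σ₃ f′ xs) _ ⟩
    Σ₂ (f′ x) xs + Σ₃ f′ xs                                ∎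
    where f′ = λ x y z → f z y x

module _ {A B : Set} (h : A → B) where

  Σ₁-map : ∀ (f : B → ℚ) xs → Σ₁ f (map h xs) ≡ Σ₁ (f ∘ h) xs
  Σ₁-map f xs = cong sumℚ (sym (List.map-∘ xs))

  Σ₂-map : ∀ (f : B → B → ℚ) xs → Σ₂ f (map h xs) ≡ Σ₂ (λ x y → f (h x) (h y)) xs
  Σ₂-map f []       = refl
  Σ₂-map f (x ∷ xs) = cong₂ _+_ (Σ₁-map (f (h x)) xs) (Σ₂-map f xs)

  Σ₃-map : ∀ (f : B → B → B → ℚ) xs → Σ₃ f (map h xs) ≡ Σ₃ (λ x y z → f (h x) (h y) (h z)) xs
  Σ₃-map f []       = refl
  Σ₃-map f (x ∷ xs) = cong₂ _+_ (Σ₂-map (f (h x)) xs) (Σ₃-map f xs)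

Σ₁-zero : ∀ {A : Set} (xs : List A) → Σ₁ (λ _ → 0ℚ) xs ≡ 0ℚ
Σ₁-zero []       = refl
Σ₁-zero (x ∷ xs) = trans (ℚ.+-identityˡ _) (Σ₁-zero xs)

applyUpTo⁺ : ∀ {A B : Set} {R : A → B → Set} {f g} n → (∀ {t} → t < n → R (f t) (g t)) →
             Pointwise R (applyUpTo f n) (applyUpTo g n)
applyUpTo⁺ zero    R-fg = []
applyUpTo⁺ (suc n) R-fg = R-fg (s≤s z≤n) ∷ applyUpTo⁺ n (λ t<n → R-fg (s≤s t<n))

applyDownFrom-applyUpTo⁺ : ∀ {A B : Set} {R : A → B → Set} {f g} n → (∀ {t} → t < n → R (f (n ∸ suc t)) (g t)) →
                           Pointwise R (applyDownFrom f n) (applyUpTo g n)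
applyDownFrom-applyUpTo⁺ zero    R-fg = []
applyDownFrom-applyUpTo⁺ (suc n) R-fg = R-fg (s≤s z≤n) ∷ applyDownFrom-applyUpTo⁺ n (λ t<n → R-fg (s≤s t<n))

Σ₁-applyUpTo-+ : ∀ {A : Set} (f : A → ℚ) u m n →
                 Σ₁ f (applyUpTo u (m ℕ.+ n)) ≡ Σ₁ f (applyUpTo u m) + Σ₁ f (applyUpTo (λ t → u (m ℕ.+ t)) n)
Σ₁-applyUpTo-+ f u zero    n = sym (ℚ.+-identityˡ _)
Σ₁-applyUpTo-+ f u (suc m) n = trans (cong (f (u 0) +_) (Σ₁-applyUpTo-+ f (u ∘ suc) m n)) (sym (ℚ.+-assoc (f (u 0)) _ _))

Σ₁-applyUpTo-*2 : ∀ {A : Set} (f : A → ℚ) u n →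
                  Σ₁ f (applyUpTo u (n * 2)) ≡ Σ₁ f (applyUpTo (λ s → u (s * 2)) n) + Σ₁ f (applyUpTo (λ s → u (suc (s * 2))) n)
Σ₁-applyUpTo-*2 f u zero    = sym (ℚ.+-identityʳ 0ℚ)
Σ₁-applyUpTo-*2 f u (suc n) =
  trans (cong (λ s → f (u 0) + (f (u 1) + s)) (Σ₁-applyUpTo-*2 f (u ∘ suc ∘ suc) n))
        (regroup (f (u 0)) (f (u 1)) _ _)
  where
  regroup : ∀ a b c d → a + (b + (c + d)) ≡ (a + c) + (b + d)
  regroup = solve 4 (λ a b c d → a :+ (b :+ (c :+ d)) := (a :+ c) :+ (b :+ d)) refl

if-<ᵇ : ∀ {m n} {A : Set} {x y : A} → m < n → (if m <ᵇ n then x else y) ≡ x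
if-<ᵇ m<n rewrite Equivalence.to T-≡ (ℕ.<⇒<ᵇ m<n) = refl

<ᵇ-≥ : ∀ {m n} → n ≤ m → (m <ᵇ n) ≡ false
<ᵇ-≥ {m} {n} n≤m = ¬-not (λ m<ᵇn → ℕ.≤⇒≯ n≤m (ℕ.<ᵇ⇒< m n (Equivalence.from T-≡ m<ᵇn)))

if-≮ᵇ : ∀ {m n} {A : Set} {x y : A} → n ≤ m → (if m <ᵇ n then x else y) ≡ y
if-≮ᵇ n≤m rewrite <ᵇ-≥ n≤m = refl

if-<ᵇ∧ : ∀ {i j} b {A : Set} {x y : A} → i < j → (if (i <ᵇ j) ∧ b then x else y) ≡ (if b then x else y)
if-<ᵇ∧ b i<j rewrite Equivalence.to T-≡ (ℕ.<⇒<ᵇ i<j) = refl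

if-≮ᵇ∧ : ∀ {i j} b {A : Set} {x y : A} → j ≤ i → (if (i <ᵇ j) ∧ b then x else y) ≡ y
if-≮ᵇ∧ b j≤i rewrite <ᵇ-≥ j≤i = refl

if-∧≮ᵇ : ∀ {j k} b {A : Set} {x y : A} → k ≤ j → (if b ∧ (j <ᵇ k) then x else y) ≡ y
if-∧≮ᵇ b k≤j rewrite <ᵇ-≥ k≤j | ∧-zeroʳ b = refl

Σ₂-sorted : ∀ (f : ℕ → ℕ → ℚ) {ks} → AllPairs _<_ ks →
            Σ₁ (λ j → Σ₁ (λ k → if j <ᵇ k then f j k else 0ℚ) ks) ks ≡ Σ₂ f ks
Σ₂-sorted f []                  = refl
Σ₂-sorted f {a ∷ ks} (a<ks ∷ ks↑) = begin
  (c a a + Σ₁ (c a) ks) + Σ₁ (λ j → c j a + Σ₁ (c j) ks) ks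
    ≡⟨ cong₂ _+_ (cong₂ _+_ (if-≮ᵇ {a} ℕ.≤-refl) (Σ₁-cong-All if-<ᵇ a<ks))
                 (Σ₁-cong-All (λ {j} a<j → cong (_+ Σ₁ (c j) ks) (if-≮ᵇ (ℕ.<⇒≤ a<j))) a<ks) ⟩
  (0ℚ + Σ₁ (f a) ks) + Σ₁ (λ j → 0ℚ + Σ₁ (c j) ks) ks
    ≡⟨ cong₂ _+_ (ℚ.+-identityˡ (Σ₁ (f a) ks)) (trans (Σ₁-cong (λ j → ℚ.+-identityˡ (Σ₁ (c j) ks)) ks) (Σ₂-sorted f ks↑)) ⟩
  Σ₁ (f a) ks + Σ₂ f ks ∎
  where
  open ≡-Reasoning
  c = λ j k → if j <ᵇ k then f j k else 0ℚ

Σ₃-sorted : ∀ (f : ℕ → ℕ → ℕ → ℚ) {ks} → AllPairs _<_ ks →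
            Σ₁ (λ i → Σ₁ (λ j → Σ₁ (λ k → if (i <ᵇ j) ∧ (j <ᵇ k) then f i j k else 0ℚ) ks) ks) ks ≡ Σ₃ f ks
Σ₃-sorted f []                    = refl
Σ₃-sorted f {a ∷ ks} (a<ks ∷ ks↑) = begin
  row a + Σ₁ row ks                                    ≡⟨ cong₂ _+_ first-row (Σ₁-cong-All later-row a<ks) ⟩
  Σ₂ (f a) ks + Σ₁ (λ i → Σ₁ (λ j → Σ₁ (c i j) ks) ks) ks ≡⟨ cong (Σ₂ (f a) ks +_) (Σ₃-sorted f ks↑) ⟩
  Σ₂ (f a) ks + Σ₃ f ks                                ∎
  where
  open ≡-Reasoning

  c : ℕ → ℕ → ℕ → ℚ
  c i j k = if (i <ᵇ j) ∧ (j <ᵇ k) then f i j k else 0ℚ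

  row : ℕ → ℚ
  row i = Σ₁ (λ j → Σ₁ (c i j) (a ∷ ks)) (a ∷ ks)

  drop-zeros : ∀ (g : ℕ → ℚ) → 0ℚ + Σ₁ (λ j → 0ℚ + g j) ks ≡ Σ₁ g ks
  drop-zeros g = trans (ℚ.+-identityˡ _) (Σ₁-cong (λ j → ℚ.+-identityˡ (g j)) ks)

  row-zero : ∀ {i} → a ≤ i → Σ₁ (c i a) (a ∷ ks) ≡ 0ℚ
  row-zero a≤i = trans (Σ₁-cong (λ k → if-≮ᵇ∧ (a <ᵇ k) a≤i) (a ∷ ks)) (Σ₁-zero (a ∷ ks))

  first-row : row a ≡ Σ₂ (f a) ks
  first-row = begin
    Σ₁ (c a a) (a ∷ ks) + Σ₁ (λ j → c a j a + Σ₁ (c a j) ks) ks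
      ≡⟨ cong₂ _+_ (row-zero ℕ.≤-refl)
           (Σ₁-cong-All (λ {j} a<j → cong₂ _+_ (if-∧≮ᵇ (a <ᵇ j) (ℕ.<⇒≤ a<j)) (Σ₁-cong (λ k → if-<ᵇ∧ (j <ᵇ k) a<j) ks)) a<ks) ⟩
    0ℚ + Σ₁ (λ j → 0ℚ + Σ₁ (λ k → if j <ᵇ k then f a j k else 0ℚ) ks) ks
      ≡⟨ drop-zeros _ ⟩
    Σ₁ (λ j → Σ₁ (λ k → if j <ᵇ k then f a j k else 0ℚ) ks) ks
      ≡⟨ Σ₂-sorted (f a) ks↑ ⟩
    Σ₂ (f a) ks ∎

  later-row : ∀ {i} → a < i → row i ≡ Σ₁ (λ j → Σ₁ (c i j) ks) ks
  later-row {i} a<i = begin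
    Σ₁ (c i a) (a ∷ ks) + Σ₁ (λ j → c i j a + Σ₁ (c i j) ks) ks
      ≡⟨ cong₂ _+_ (row-zero (ℕ.<⇒≤ a<i))
           (Σ₁-cong-All (λ {j} a<j → cong (_+ Σ₁ (c i j) ks) (if-∧≮ᵇ (i <ᵇ j) (ℕ.<⇒≤ a<j))) a<ks) ⟩
    0ℚ + Σ₁ (λ j → 0ℚ + Σ₁ (c i j) ks) ks
      ≡⟨ drop-zeros _ ⟩
    Σ₁ (λ j → Σ₁ (c i j) ks) ks ∎

sumℚ-++ : ∀ xs ys → sumℚ (xs ++ ys) ≡ sumℚ xs + sumℚ ys
sumℚ-++ []       ys = sym (ℚ.+-identityˡ (sumℚ ys))
sumℚ-++ (x ∷ xs) ys = trans (cong (x +_) (sumℚ-++ xs ys)) (sym (ℚ.+-assoc x (sumℚ xs) (sumℚ ys)))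

sumℚ-concatMap : ∀ {A : Set} (g : A → List ℚ) xs → sumℚ (concatMap g xs) ≡ Σ₁ (sumℚ ∘ g) xs
sumℚ-concatMap g []       = refl
sumℚ-concatMap g (x ∷ xs) = trans (sumℚ-++ (g x) (concatMap g xs)) (cong (sumℚ (g x) +_) (sumℚ-concatMap g xs))

range1-sorted : ∀ n → AllPairs _<_ (range1 n)
range1-sorted n = AllPairs.applyUpTo⁺₁ suc n (λ i<j _ → s≤s i<j)

reciprocals : ℕ → List ℚ
reciprocals n = applyUpTo (λ t → inv (suc t)) n

tripleSum≡Σ₃ : ∀ p (f : ℕ → ℕ → ℕ → ℚ) (g : ℚ → ℚ → ℚ → ℚ) →
               (∀ i j k → f i j k ≡ g (inv i) (inv j) (inv k)) → tripleSum p f ≡ Σ₃ g (reciprocals (p ∸ 1))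
tripleSum≡Σ₃ p f g f≡g = begin
  tripleSum p f
    ≡⟨ sumℚ-concatMap _ ks ⟩
  Σ₁ (λ i → sumℚ (concatMap (λ j → map (c i j) ks) ks)) ks
    ≡⟨ Σ₁-cong (λ i → sumℚ-concatMap _ ks) ks ⟩
  Σ₁ (λ i → Σ₁ (λ j → Σ₁ (c i j) ks) ks) ks
    ≡⟨ Σ₃-sorted f (range1-sorted (p ∸ 1)) ⟩
  Σ₃ f ks
    ≡⟨ Σ₃-cong f≡g ks ⟩
  Σ₃ (λ i j k → g (inv i) (inv j) (inv k)) ks
    ≡⟨ Σ₃-map inv g ks ⟨
  Σ₃ g (map inv ks)
    ≡⟨ cong (Σ₃ g) (List.map-applyUpTo suc inv (p ∸ 1)) ⟩
  Σ₃ g (reciprocals (p ∸ 1)) ∎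
  where
  open ≡-Reasoning
  ks = range1 (p ∸ 1)
  c = λ i j k → if (i <ᵇ j) ∧ (j <ᵇ k) then f i j k else 0ℚ

P₁ P₂ P₃ P₄ E₂ H₂₁ H₁₂ H₂₁₁ H₁₂₁ H₁₁₂ : List ℚ → ℚ
P₁   = Σ₁ (λ x → x)
P₂   = Σ₁ (λ x → x · x)
P₃   = Σ₁ (λ x → x · x · x)
P₄   = Σ₁ (λ x → x · x · (x · x))
E₂   = Σ₂ _·_
H₂₁  = Σ₂ (λ x y → x · x · y)
H₁₂  = Σ₂ (λ x y → x · (y · y))
H₂₁₁ = Σ₃ (λ x y z → x · x · (y · z))
H₁₂₁ = Σ₃ (λ x y z → x · (y · y · z))
H₁₁₂ = Σ₃ (λ x y z → x · (y · (z · z)))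

H₂₁+H₁₂≡P₁P₂-P₃ : ∀ xs → H₂₁ xs + H₁₂ xs ≡ P₁ xs · P₂ xs - P₃ xs
H₂₁+H₁₂≡P₁P₂-P₃ []       = refl
H₂₁+H₁₂≡P₁P₂-P₃ (a ∷ xs) = begin
  (Σ₁ (λ y → a · a · y) xs + H₂₁ xs) + (Σ₁ (λ y → a · (y · y)) xs + H₁₂ xs)
    ≡⟨ cong₂ (λ u v → (u + H₂₁ xs) + (v + H₁₂ xs)) (Σ₁-·ˡ (a · a) id xs) (Σ₁-·ˡ a (λ y → y · y) xs) ⟩
  (a · a · P₁ xs + H₂₁ xs) + (a · P₂ xs + H₁₂ xs)
    ≡⟨ +-interchange (a · a · P₁ xs) (H₂₁ xs) (a · P₂ xs) (H₁₂ xs) ⟩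
  a · a · P₁ xs + a · P₂ xs + (H₂₁ xs + H₁₂ xs)
    ≡⟨ cong (a · a · P₁ xs + a · P₂ xs +_) (H₂₁+H₁₂≡P₁P₂-P₃ xs) ⟩
  a · a · P₁ xs + a · P₂ xs + (P₁ xs · P₂ xs - P₃ xs)
    ≡⟨ expand a (P₁ xs) (P₂ xs) (P₃ xs) ⟩
  (a + P₁ xs) · (a · a + P₂ xs) - (a · a · a + P₃ xs) ∎
  where
  open ≡-Reasoning
  expand : ∀ a p₁ p₂ p₃ → a · a · p₁ + a · p₂ + (p₁ · p₂ - p₃) ≡ (a + p₁) · (a · a + p₂) - (a · a · a + p₃)
  expand = solve 4 (λ a p₁ p₂ p₃ → a :* a :* p₁ :+ a :* p₂ :+ (p₁ :* p₂ :- p₃)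
                                := (a :+ p₁) :* (a :* a :+ p₂) :- (a :* a :* a :+ p₃)) refl

H₂₁₁+H₁₂₁+H₁₁₂≡P₂E₂-P₃P₁+P₄ : ∀ xs → H₂₁₁ xs + H₁₂₁ xs + H₁₁₂ xs ≡ P₂ xs · E₂ xs - P₃ xs · P₁ xs + P₄ xs
H₂₁₁+H₁₂₁+H₁₁₂≡P₂E₂-P₃P₁+P₄ []       = refl
H₂₁₁+H₁₂₁+H₁₁₂≡P₂E₂-P₃P₁+P₄ (a ∷ xs) = begin
  (Σ₂ (λ y z → a · a · (y · z)) xs + H₂₁₁ xs) + (Σ₂ (λ y z → a · (y · y · z)) xs + H₁₂₁ xs)
    + (Σ₂ (λ y z → a · (y · (z · z))) xs + H₁₁₂ xs)
    ≡⟨ cong₂ _+_ (cong₂ (λ u v → (u + H₂₁₁ xs) + (v + H₁₂₁ xs)) (Σ₂-·ˡ (a · a) _·_ xs) (Σ₂-·ˡ a (λ y z → y · y · z) xs))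
                 (cong (_+ H₁₁₂ xs) (Σ₂-·ˡ a (λ y z → y · (z · z)) xs)) ⟩
  (a · a · E₂ xs + H₂₁₁ xs) + (a · H₂₁ xs + H₁₂₁ xs) + (a · H₁₂ xs + H₁₁₂ xs)
    ≡⟨ regroup (a · a · E₂ xs) (H₂₁₁ xs) a (H₂₁ xs) (H₁₂₁ xs) (H₁₂ xs) (H₁₁₂ xs) ⟩
  a · a · E₂ xs + a · (H₂₁ xs + H₁₂ xs) + (H₂₁₁ xs + H₁₂₁ xs + H₁₁₂ xs)
    ≡⟨ cong₂ (λ u v → a · a · E₂ xs + a · u + v) (H₂₁+H₁₂≡P₁P₂-P₃ xs) (H₂₁₁+H₁₂₁+H₁₁₂≡P₂E₂-P₃P₁+P₄ xs) ⟩
  a · a · E₂ xs + a · (P₁ xs · P₂ xs - P₃ xs) + (P₂ xs · E₂ xs - P₃ xs · P₁ xs + P₄ xs)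
    ≡⟨ expand a (P₁ xs) (P₂ xs) (P₃ xs) (P₄ xs) (E₂ xs) ⟩
  (a · a + P₂ xs) · (a · P₁ xs + E₂ xs) - (a · a · a + P₃ xs) · (a + P₁ xs) + (a · a · (a · a) + P₄ xs)
    ≡⟨ cong (λ e → (a · a + P₂ xs) · (e + E₂ xs) - (a · a · a + P₃ xs) · (a + P₁ xs) + (a · a · (a · a) + P₄ xs))
            (Σ₁-·ˡ a id xs) ⟨
  P₂ (a ∷ xs) · E₂ (a ∷ xs) - P₃ (a ∷ xs) · P₁ (a ∷ xs) + P₄ (a ∷ xs) ∎
  where
  open ≡-Reasoning
  regroup : ∀ u h₁ a h₂ k₁ h₃ k₂ → (u + h₁) + (a · h₂ + k₁) + (a · h₃ + k₂) ≡ u + a · (h₂ + h₃) + (h₁ + k₁ + k₂)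
  regroup = solve 7 (λ u h₁ a h₂ k₁ h₃ k₂ → (u :+ h₁) :+ (a :* h₂ :+ k₁) :+ (a :* h₃ :+ k₂)
                                         := u :+ a :* (h₂ :+ h₃) :+ (h₁ :+ k₁ :+ k₂)) refl
  expand : ∀ a p₁ p₂ p₃ p₄ e₂ → a · a · e₂ + a · (p₁ · p₂ - p₃) + (p₂ · e₂ - p₃ · p₁ + p₄)
           ≡ (a · a + p₂) · (a · p₁ + e₂) - (a · a · a + p₃) · (a + p₁) + (a · a · (a · a) + p₄)
  expand = solve 6 (λ a p₁ p₂ p₃ p₄ e₂ → a :* a :* e₂ :+ a :* (p₁ :* p₂ :- p₃) :+ (p₂ :* e₂ :- p₃ :* p₁ :+ p₄)
                    := (a :* a :+ p₂) :* (a :* p₁ :+ e₂) :- (a :* a :* a :+ p₃) :* (a :+ p₁) :+ (a :* a :* (a :* a) :+ p₄)) refl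

↧ₙ-/-∣ : ∀ i n .{{_ : NonZero n}} → ↧ₙ (i / n) ∣ n
↧ₙ-/-∣ i n = divides g (trans (sym ↧ₙ*g≡n) (ℕ.*-comm (↧ₙ (i / n)) g))
  where
  g = gcd ℤ.∣ i ∣ n
  ↧ₙ*g≡n : ↧ₙ (i / n) * g ≡ n
  ↧ₙ*g≡n = trans (sym (ℤ.abs-* (↧ (i / n)) (ℤ.+ g))) (cong ℤ.∣_∣ (ℚ.↧-/ i n))

module Congruence {p : ℕ} (p-prime : Prime p) where

  -- a ∈ ℤ₍ₚ₎ and a ∈ pℤ₍ₚ₎, as records so that a can be inferred.
  record Integral (a : ℚ) : Set where
    constructor integral
    field p∤↧ₙ : ¬ p ∣ ↧ₙ a

  record Divisible (a : ℚ) : Set where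
    constructor divisible
    field
      isIntegral : Integral a
      p∣↥        : ℤ.+ p ∣ℤ ↥ a

  p∤1 : ¬ p ∣ 1
  p∤1 p∣1 = ¬prime[1] (subst Prime (∣1⇒≡1 p∣1) p-prime)

  integral-0 : Integral 0ℚ
  integral-0 = integral p∤1

  ∤-* : ∀ {m n} → ¬ p ∣ m → ¬ p ∣ n → ¬ p ∣ m * n
  ∤-* p∤m p∤n p∣mn = [ p∤m , p∤n ]′ (euclidsLemma _ _ p-prime p∣mn)

  ∣-cancelʳ : ∀ {i g} → ℤ.+ p ∣ℤ i ℤ.* ℤ.+ g → ¬ p ∣ g → ℤ.+ p ∣ℤ i
  ∣-cancelʳ {i} {g} p∣ig p∤g = ∣ᵤ⇒∣ ([ id , ⊥-elim ∘ p∤g ]′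
    (euclidsLemma ℤ.∣ i ∣ g p-prime (subst (p ∣_) (ℤ.abs-* i (ℤ.+ g)) (∣⇒∣ᵤ p∣ig))))

  integral-/ : ∀ i n .{{_ : NonZero n}} → ¬ p ∣ n → Integral (i / n)
  integral-/ i n p∤n = integral (λ p∣↧ → p∤n (∣-trans p∣↧ (↧ₙ-/-∣ i n)))

  divisible-/ : ∀ i n .{{_ : NonZero n}} → ¬ p ∣ n → ℤ.+ p ∣ℤ i → Divisible (i / n)
  divisible-/ i n p∤n p∣i = divisible (integral-/ i n p∤n)
    (∣-cancelʳ (subst (ℤ.+ p ∣ℤ_) (sym (ℚ.↥-/ i n)) p∣i) (λ p∣g → p∤n (∣-trans p∣g (gcd[m,n]∣n ℤ.∣ i ∣ n))))

  integral-+ : ∀ {a b} → Integral a → Integral b → Integral (a + b)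
  integral-+ {a@record{}} {b@record{}} (integral ia) (integral ib) =
    integral-/ (↥ a ℤ.* ↧ b ℤ.+ ↥ b ℤ.* ↧ a) (↧ₙ a * ↧ₙ b) (∤-* ia ib)

  integral-· : ∀ {a b} → Integral a → Integral b → Integral (a · b)
  integral-· {a@record{}} {b@record{}} (integral ia) (integral ib) =
    integral-/ (↥ a ℤ.* ↥ b) (↧ₙ a * ↧ₙ b) (∤-* ia ib)

  integral-neg : ∀ {a} → Integral a → Integral (- a)
  integral-neg {a} (integral ia) = integral (subst (λ d → ¬ p ∣ ℤ.∣ d ∣) (sym (ℚ.↧-neg a)) ia)

  divisible-0 : Divisible 0ℚ
  divisible-0 = divisible integral-0 (∣ᵤ⇒∣ (p ∣0))

  divisible-+-numerator : ∀ {a b} → Integral a → Integral b →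
                          ℤ.+ p ∣ℤ ↥ a ℤ.* ↧ b ℤ.+ ↥ b ℤ.* ↧ a → Divisible (a + b)
  divisible-+-numerator {a@record{}} {b@record{}} (integral ia) (integral ib) =
    divisible-/ (↥ a ℤ.* ↧ b ℤ.+ ↥ b ℤ.* ↧ a) (↧ₙ a * ↧ₙ b) (∤-* ia ib)

  divisible-+ : ∀ {a b} → Divisible a → Divisible b → Divisible (a + b)
  divisible-+ {a} {b} (divisible ia p∣a) (divisible ib p∣b) =
    divisible-+-numerator ia ib (∣m∣n⇒∣m+n (∣m⇒∣m*n (↧ b) p∣a) (∣m⇒∣m*n (↧ a) p∣b))

  divisible-· : ∀ {a b} → Divisible a → Integral b → Divisible (a · b)
  divisible-· {a@record{}} {b@record{}} (divisible (integral ia) p∣a) (integral ib) =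
    divisible-/ (↥ a ℤ.* ↥ b) (↧ₙ a * ↧ₙ b) (∤-* ia ib) (∣m⇒∣m*n (↥ b) p∣a)

  divisible-neg : ∀ {a} → Divisible a → Divisible (- a)
  divisible-neg {a} (divisible ia p∣a) =
    divisible (integral-neg ia) (subst (ℤ.+ p ∣ℤ_) (sym (ℚ.↥-neg a)) (∣m⇒∣-m p∣a))

  -- _≡_[modℚ p ] as a record, so that a and b can be inferred.
  infix 4 _≈_
  record _≈_ (a b : ℚ) : Set where
    field
      integralˡ : Integral a
      integralʳ : Integral b
      p∣↥[a-b]  : ℤ.+ p ∣ℤ ↥ (a - b)
  open _≈_ public

  ≈-from-difference : ∀ {a b c} → Integral a → Integral b → a - b ≡ c → Divisible c → a ≈ b
  ≈-from-difference ia ib refl (divisible _ p∣c) =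
    record { integralˡ = ia ; integralʳ = ib ; p∣↥[a-b] = p∣c }

  difference-divisible : ∀ {a b} → a ≈ b → Divisible (a - b)
  difference-divisible a≈b = divisible (integral-+ (integralˡ a≈b) (integral-neg (integralʳ a≈b))) (p∣↥[a-b] a≈b)

  ≈-refl : ∀ {a} → Integral a → a ≈ a
  ≈-refl {a} ia = ≈-from-difference ia ia (ℚ.+-inverseʳ a) divisible-0

  ≈-reflexive : ∀ {a b} → a ≡ b → Integral a → a ≈ b
  ≈-reflexive refl = ≈-refl

  ≈-sym : ∀ {a b} → a ≈ b → b ≈ a
  ≈-sym {a} {b} a≈b = ≈-from-difference (integralʳ a≈b) (integralˡ a≈b) (b-a≡-[a-b] a b)
    (divisible-neg (difference-divisible a≈b))
    where
    b-a≡-[a-b] : ∀ a b → b - a ≡ - (a - b)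
    b-a≡-[a-b] = solve 2 (λ a b → b :- a := :- (a :- b)) refl

  ≈-trans : ∀ {a b c} → a ≈ b → b ≈ c → a ≈ c
  ≈-trans {a} {b} {c} a≈b b≈c = ≈-from-difference (integralˡ a≈b) (integralʳ b≈c) (telescope a b c)
    (divisible-+ (difference-divisible a≈b) (difference-divisible b≈c))
    where
    telescope : ∀ a b c → a - c ≡ (a - b) + (b - c)
    telescope = solve 3 (λ a b c → a :- c := (a :- b) :+ (b :- c)) refl

  +-cong : ∀ {a b c d} → a ≈ b → c ≈ d → a + c ≈ b + d
  +-cong {a} {b} {c} {d} a≈b c≈d =
    ≈-from-difference (integral-+ (integralˡ a≈b) (integralˡ c≈d)) (integral-+ (integralʳ a≈b) (integralʳ c≈d))
      (interchange a b c d) (divisible-+ (difference-divisible a≈b) (difference-divisible c≈d))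
    where
    interchange : ∀ a b c d → (a + c) - (b + d) ≡ (a - b) + (c - d)
    interchange = solve 4 (λ a b c d → (a :+ c) :- (b :+ d) := (a :- b) :+ (c :- d)) refl

  ·-cong : ∀ {a b c d} → a ≈ b → c ≈ d → a · c ≈ b · d
  ·-cong {a} {b} {c} {d} a≈b c≈d =
    ≈-from-difference (integral-· (integralˡ a≈b) (integralˡ c≈d)) (integral-· (integralʳ a≈b) (integralʳ c≈d))
      (split a b c d)
      (divisible-+ (divisible-· (difference-divisible a≈b) (integralˡ c≈d))
                   (divisible-· (difference-divisible c≈d) (integralʳ a≈b)))
    where
    split : ∀ a b c d → a · c - b · d ≡ (a - b) · c + (c - d) · b
    split = solve 4 (λ a b c d → a :* c :- b :* d := (a :- b) :* c :+ (c :- d) :* b) refl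

  -‿cong : ∀ {a b} → a ≈ b → - a ≈ - b
  -‿cong {a} {b} a≈b = ≈-from-difference (integral-neg (integralˡ a≈b)) (integral-neg (integralʳ a≈b)) (neg-sub a b)
    (divisible-neg (difference-divisible a≈b))
    where
    neg-sub : ∀ a b → (- a) - (- b) ≡ - (a - b)
    neg-sub = solve 2 (λ a b → (:- a) :- (:- b) := :- (a :- b)) refl

  ≈-partialSetoid : PartialSetoid _ _
  ≈-partialSetoid = record { _≈_ = _≈_ ; isPartialEquivalence = record { sym = ≈-sym ; trans = ≈-trans } }

  module ≈-Reasoning = PartialSetoidReasoning ≈-partialSetoid

  x≈y⇒x-y≈0 : ∀ {a b} → a ≈ b → a - b ≈ 0ℚ
  x≈y⇒x-y≈0 {a} {b} a≈b = begin
    a - b ≈⟨ +-cong a≈b (≈-refl (integral-neg (integralʳ a≈b))) ⟩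
    b - b ≡⟨ ℚ.+-inverseʳ b ⟩
    0ℚ    ∎
    where open ≈-Reasoning

  ≈⇒≡[modℚ] : ∀ {a b} → a ≈ b → a ≡ b [modℚ p ]
  ≈⇒≡[modℚ] a≈b = Integral.p∤↧ₙ (integralˡ a≈b) , Integral.p∤↧ₙ (integralʳ a≈b) , ∣⇒∣ᵤ (p∣↥[a-b] a≈b)

  ≈-cross : ∀ {a b} → Integral a → Integral b → ℤ.+ p ∣ℤ ↥ a ℤ.* ↧ b ℤ.- ↥ b ℤ.* ↧ a → a ≈ b
  ≈-cross {a} {b} ia ib p∣cross =
    ≈-from-difference ia ib refl (divisible-+-numerator ia (integral-neg ib) (subst (ℤ.+ p ∣ℤ_) cross≡ p∣cross))
    where
    cross≡ : ↥ a ℤ.* ↧ b ℤ.- ↥ b ℤ.* ↧ a ≡ ↥ a ℤ.* ↧ (- b) ℤ.+ ↥ (- b) ℤ.* ↧ a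
    cross≡ = trans (cong (ℤ._+_ (↥ a ℤ.* ↧ b)) (ℤ.neg-distribˡ-* (↥ b) (↧ a)))
                   (cong₂ (λ d n → ↥ a ℤ.* d ℤ.+ n ℤ.* ↧ a) (sym (ℚ.↧-neg b)) (sym (ℚ.↥-neg b)))

  /-≈ : ∀ i j m n .{{_ : NonZero m}} .{{_ : NonZero n}} → ¬ p ∣ m → ¬ p ∣ n →
        ℤ.+ p ∣ℤ i ℤ.* ℤ.+ n ℤ.- j ℤ.* ℤ.+ m → i / m ≈ j / n
  /-≈ i j m n p∤m p∤n p∣cross = ≈-cross (integral-/ i m p∤m) (integral-/ j n p∤n)
    (∣-cancelʳ (subst (ℤ.+ p ∣ℤ_) (sym cross≡) p∣cross) (∤-* (gcd-∤ i m p∤m) (gcd-∤ j n p∤n)))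
    where
    gcd-∤ : ∀ k l → ¬ p ∣ l → ¬ p ∣ gcd ℤ.∣ k ∣ l
    gcd-∤ k l p∤l p∣g = p∤l (∣-trans p∣g (gcd[m,n]∣n ℤ.∣ k ∣ l))
    g = gcd ℤ.∣ i ∣ m
    h = gcd ℤ.∣ j ∣ n
    a = i / m
    b = j / n
    rearrange : ∀ u v w x G H → (u ℤ.* v ℤ.- w ℤ.* x) ℤ.* (G ℤ.* H) ≡ (u ℤ.* G) ℤ.* (v ℤ.* H) ℤ.- (w ℤ.* H) ℤ.* (x ℤ.* G)
    rearrange = ℤS.solve 6 (λ u v w x G H → (u ℤS.:* v ℤS.:- w ℤS.:* x) ℤS.:* (G ℤS.:* H)
                  ℤS.:= (u ℤS.:* G) ℤS.:* (v ℤS.:* H) ℤS.:- (w ℤS.:* H) ℤS.:* (x ℤS.:* G)) refl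
    cross≡ : (↥ a ℤ.* ↧ b ℤ.- ↥ b ℤ.* ↧ a) ℤ.* ℤ.+ (g * h) ≡ i ℤ.* ℤ.+ n ℤ.- j ℤ.* ℤ.+ m
    cross≡ = begin
      (↥ a ℤ.* ↧ b ℤ.- ↥ b ℤ.* ↧ a) ℤ.* ℤ.+ (g * h)
        ≡⟨ cong (ℤ._*_ (↥ a ℤ.* ↧ b ℤ.- ↥ b ℤ.* ↧ a)) (ℤ.pos-* g h) ⟩
      (↥ a ℤ.* ↧ b ℤ.- ↥ b ℤ.* ↧ a) ℤ.* (ℤ.+ g ℤ.* ℤ.+ h)
        ≡⟨ rearrange (↥ a) (↧ b) (↥ b) (↧ a) (ℤ.+ g) (ℤ.+ h) ⟩
      (↥ a ℤ.* ℤ.+ g) ℤ.* (↧ b ℤ.* ℤ.+ h) ℤ.- (↥ b ℤ.* ℤ.+ h) ℤ.* (↧ a ℤ.* ℤ.+ g)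
        ≡⟨ cong₂ (λ u v → u ℤ.- v) (cong₂ ℤ._*_ (ℚ.↥-/ i m) (ℚ.↧-/ j n)) (cong₂ ℤ._*_ (ℚ.↥-/ j n) (ℚ.↧-/ i m)) ⟩
      i ℤ.* ℤ.+ n ℤ.- j ℤ.* ℤ.+ m ∎
      where open ≡-Reasoning

  inv-integral : ∀ {n} → ¬ p ∣ n → Integral (inv n)
  inv-integral {zero}  _   = integral-0
  inv-integral {suc n} p∤n = integral-/ (ℤ.+ 1) (suc n) p∤n

  inv-≈-+p : ∀ {m} → ¬ p ∣ m → inv m ≈ inv (m ℕ.+ p)
  inv-≈-+p {zero}  p∤0 = ⊥-elim (p∤0 (p ∣0))
  inv-≈-+p {suc m} p∤m = /-≈ (ℤ.+ 1) (ℤ.+ 1) (suc m) (suc m ℕ.+ p) p∤m p∤m+p (subst (ℤ.+ p ∣ℤ_) cross≡ ℤ∣-refl)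
    where
    p∤m+p : ¬ p ∣ suc m ℕ.+ p
    p∤m+p p∣m+p = p∤m (∣m+n∣m⇒∣n (subst (p ∣_) (ℕ.+-comm (suc m) p) p∣m+p) (∣-reflexive refl))
    cross≡ : ℤ.+ p ≡ ℤ.+ 1 ℤ.* ℤ.+ (suc m ℕ.+ p) ℤ.- ℤ.+ 1 ℤ.* ℤ.+ suc m
    cross≡ = trans (ℤS.solve 2 (λ x y → y ℤS.:= ℤS.con (ℤ.+ 1) ℤS.:* (x ℤS.:+ y) ℤS.:- ℤS.con (ℤ.+ 1) ℤS.:* x) refl
                                (ℤ.+ suc m) (ℤ.+ p))
                   (cong (λ z → ℤ.+ 1 ℤ.* z ℤ.- ℤ.+ 1 ℤ.* ℤ.+ suc m) (sym (ℤ.pos-+ (suc m) p)))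

  inv-≈-neg : ∀ {m n} → ¬ p ∣ m → ¬ p ∣ n → p ∣ m ℕ.+ n → inv m ≈ - inv n
  inv-≈-neg {zero}          p∤0 _ _ = ⊥-elim (p∤0 (p ∣0))
  inv-≈-neg {suc m} {zero}  _ p∤0 _ = ⊥-elim (p∤0 (p ∣0))
  inv-≈-neg {suc m} {suc n} p∤m p∤n p∣m+n = /-≈ (ℤ.+ 1) ℤ.-1ℤ (suc m) (suc n) p∤m p∤n
    (subst (ℤ.+ p ∣ℤ_) cross≡ (∣ᵤ⇒∣ p∣m+n))
    where
    cross≡ : ℤ.+ (suc m ℕ.+ suc n) ≡ ℤ.+ 1 ℤ.* ℤ.+ suc n ℤ.- ℤ.-1ℤ ℤ.* ℤ.+ suc m
    cross≡ = trans (ℤ.pos-+ (suc m) (suc n))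
      (ℤS.solve 2 (λ x y → x ℤS.:+ y ℤS.:= ℤS.con (ℤ.+ 1) ℤS.:* y ℤS.:- ℤS.con ℤ.-1ℤ ℤS.:* x) refl (ℤ.+ suc m) (ℤ.+ suc n))

  Σ₁-cong≈ : ∀ {f g : ℚ → ℚ} → (∀ {x x′} → x ≈ x′ → f x ≈ g x′) →
             ∀ {xs ys} → Pointwise _≈_ xs ys → Σ₁ f xs ≈ Σ₁ g ys
  Σ₁-cong≈ f-cong []            = ≈-refl integral-0
  Σ₁-cong≈ f-cong (x≈y ∷ xs≈ys) = +-cong (f-cong x≈y) (Σ₁-cong≈ f-cong xs≈ys)

  Σ₂-cong≈ : ∀ {f g : ℚ → ℚ → ℚ} → (∀ {x x′ y y′} → x ≈ x′ → y ≈ y′ → f x y ≈ g x′ y′) →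
             ∀ {xs ys} → Pointwise _≈_ xs ys → Σ₂ f xs ≈ Σ₂ g ys
  Σ₂-cong≈ f-cong []            = ≈-refl integral-0
  Σ₂-cong≈ f-cong (x≈y ∷ xs≈ys) = +-cong (Σ₁-cong≈ (f-cong x≈y) xs≈ys) (Σ₂-cong≈ f-cong xs≈ys)

  Σ₃-cong≈ : ∀ {f g : ℚ → ℚ → ℚ → ℚ} → (∀ {x x′ y y′ z z′} → x ≈ x′ → y ≈ y′ → z ≈ z′ → f x y z ≈ g x′ y′ z′) →
             ∀ {xs ys} → Pointwise _≈_ xs ys → Σ₃ f xs ≈ Σ₃ g ys
  Σ₃-cong≈ f-cong []            = ≈-refl integral-0
  Σ₃-cong≈ f-cong (x≈y ∷ xs≈ys) = +-cong (Σ₂-cong≈ (f-cong x≈y) xs≈ys) (Σ₃-cong≈ f-cong xs≈ys)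

prime⇒odd : ∀ {p} → Prime p → 3 ≤ p → ∃[ h ] p ≡ suc (h * 2)
prime⇒odd {p} p-prime 3≤p = p ℕ./ 2 , trans (DivMod.m≡m%n+[m/n]*n p 2) (cong (ℕ._+ p ℕ./ 2 * 2) p%2≡1)
  where
  p%2≡1 : p ℕ.% 2 ≡ 1
  p%2≡1 with p ℕ.% 2 in p%2≡ | DivMod.m%n<n p 2
  ... | 0 | _ = [ (λ ()) , (λ 2≡p → ⊥-elim (ℕ.<-irrefl 2≡p 3≤p)) ]′ (prime⇒irreducible p-prime (m%n≡0⇒n∣m p 2 p%2≡))
  ... | 1 | _ = refl
  ... | suc (suc _) | s≤s (s≤s ())

module OddPrime (h : ℕ) (p-prime : Prime (suc (h * 2))) where

  open Congruence p-prime public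

  private
    p n : ℕ
    p = suc (h * 2)
    n = h * 2

  x : ℕ → ℚ
  x t = inv (suc t)

  xs : List ℚ
  xs = reciprocals n

  x-integral : ∀ {t} → t < n → Integral (x t)
  x-integral t<n = inv-integral (>⇒∤ (s≤s t<n))

  xs≈xs : Pointwise _≈_ xs xs
  xs≈xs = applyUpTo⁺ n (λ t<n → ≈-refl (x-integral t<n))

  reverse-xs≈-xs : Pointwise _≈_ (reverse xs) (map -_ xs)
  reverse-xs≈-xs = subst₂ (Pointwise _≈_) (sym (List.reverse-applyUpTo x n)) (sym (List.map-applyUpTo x -_ n))
    (applyDownFrom-applyUpTo⁺ n x[n-1-t]≈-x[t])
    where
    x[n-1-t]≈-x[t] : ∀ {t} → t < n → x (n ∸ suc t) ≈ - x t
    x[n-1-t]≈-x[t] t<n = inv-≈-neg (>⇒∤ (s≤s (ℕ.∸-monoʳ-< z<s t<n))) (>⇒∤ (s≤s t<n))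
      (∣-reflexive (sym (cong suc (ℕ.m∸n+n≡m t<n))))

  -- An odd t + 1 = 2s + 1 is replaced by 2s + 1 + p = 2(h + s + 1), an even one is 2(s + 1).
  halving : ∀ {g} → (∀ {a b} → a ≈ b → g a ≈ g b) → Σ₁ g xs ≈ Σ₁ (λ y → g (y · ½)) xs
  halving {g} g-cong = begin
    Σ₁ g (applyUpTo x (h * 2))
      ≡⟨ Σ₁-applyUpTo-*2 g x h ⟩
    Σ₁ g (applyUpTo (λ s → x (s * 2)) h) + Σ₁ g (applyUpTo (λ s → x (suc (s * 2))) h)
      ≈⟨ +-cong (Σ₁-cong≈ g-cong (applyUpTo⁺ h odd≈)) (Σ₁-cong≈ g-cong (applyUpTo⁺ h even≈)) ⟩
    Σ₁ g (applyUpTo (λ s → x (h ℕ.+ s) · ½) h) + Σ₁ g (applyUpTo (λ s → x s · ½) h)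
      ≡⟨ ℚ.+-comm (Σ₁ g (applyUpTo (λ s → x (h ℕ.+ s) · ½) h)) _ ⟩
    Σ₁ g (applyUpTo (λ s → x s · ½) h) + Σ₁ g (applyUpTo (λ s → x (h ℕ.+ s) · ½) h)
      ≡⟨ Σ₁-applyUpTo-+ g (λ t → x t · ½) h h ⟨
    Σ₁ g (applyUpTo (λ t → x t · ½) (h ℕ.+ h))
      ≡⟨ cong (λ m → Σ₁ g (applyUpTo (λ t → x t · ½) m)) h+h≡h*2 ⟩
    Σ₁ g (applyUpTo (λ t → x t · ½) (h * 2))
      ≡⟨ cong (Σ₁ g) (List.map-applyUpTo x (_· ½) n) ⟨
    Σ₁ g (map (_· ½) xs)
      ≡⟨ Σ₁-map (_· ½) g xs ⟩
    Σ₁ (λ y → g (y · ½)) xs ∎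
    where
    open ≈-Reasoning
    h+h≡h*2 : h ℕ.+ h ≡ h * 2
    h+h≡h*2 = trans (cong (h ℕ.+_) (sym (ℕ.+-identityʳ h))) (ℕ.*-comm 2 h)
    even≈ : ∀ {s} → s < h → x (suc (s * 2)) ≈ x s · ½
    even≈ {s} s<h = ≈-reflexive (inv-· (suc s) 2) (x-integral (ℕ.*-monoˡ-≤ 2 s<h))
    m+p≡[h+s+1]*2 : ∀ s h → suc (s * 2) ℕ.+ suc (h * 2) ≡ suc (h ℕ.+ s) * 2
    m+p≡[h+s+1]*2 = ℕS.solve 2 (λ s h → (ℕS.con 1 ℕS.:+ s ℕS.:* ℕS.con 2) ℕS.:+ (ℕS.con 1 ℕS.:+ h ℕS.:* ℕS.con 2)
                                 ℕS.:= (ℕS.con 1 ℕS.:+ (h ℕS.:+ s)) ℕS.:* ℕS.con 2) refl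
    odd≈ : ∀ {s} → s < h → x (s * 2) ≈ x (h ℕ.+ s) · ½
    odd≈ {s} s<h = begin
      inv (suc (s * 2))          ≈⟨ inv-≈-+p (>⇒∤ (s≤s (ℕ.*-monoˡ-< 2 s<h))) ⟩
      inv (suc (s * 2) ℕ.+ p)    ≡⟨ cong inv (m+p≡[h+s+1]*2 s h) ⟩
      inv (suc (h ℕ.+ s) * 2)    ≡⟨ inv-· (suc (h ℕ.+ s)) 2 ⟩
      x (h ℕ.+ s) · ½            ∎

  powerSum≈0 : ∀ {g} → (∀ {a b} → a ≈ b → g a ≈ g b) → ∀ d e → Integral e → e · (d - 1ℚ) ≡ 1ℚ →
               (∀ y → g y ≡ d · g (y · ½)) → Σ₁ g xs ≈ 0ℚ
  powerSum≈0 {g} g-cong d e e-integral e[d-1]≡1 homogeneous = ≈-trans P≈Q Q≈0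
    where
    open ≈-Reasoning
    P = Σ₁ g xs
    Q = Σ₁ (λ y → g (y · ½)) xs
    P≈Q : P ≈ Q
    P≈Q = halving g-cong
    P≡dQ : P ≡ d · Q
    P≡dQ = trans (Σ₁-cong homogeneous xs) (Σ₁-·ˡ d (λ y → g (y · ½)) xs)
    Q≈0 : Q ≈ 0ℚ
    Q≈0 = begin
      Q                   ≡⟨ ℚ.*-identityˡ Q ⟨
      1ℚ · Q              ≡⟨ cong (_· Q) e[d-1]≡1 ⟨
      e · (d - 1ℚ) · Q    ≡⟨ distrib e d Q ⟩
      e · (d · Q - Q)     ≡⟨ cong (λ dQ → e · (dQ - Q)) P≡dQ ⟨
      e · (P - Q)         ≈⟨ ·-cong (≈-refl e-integral) (x≈y⇒x-y≈0 P≈Q) ⟩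
      e · 0ℚ              ≡⟨ ℚ.*-zeroʳ e ⟩
      0ℚ                  ∎
      where
      distrib : ∀ e d q → e · (d - 1ℚ) · q ≡ e · (d · q - q)
      distrib = solve 3 (λ e d q → e :* (d :- con 1ℚ) :* q := e :* (d :* q :- q)) refl

  H₂₁₁≈H₁₁₂ : H₂₁₁ xs ≈ H₁₁₂ xs
  H₂₁₁≈H₁₁₂ = begin
    H₂₁₁ xs                                   ≡⟨ Σ₃-cong (λ a b c → even-in-signs a b c) xs ⟩
    Σ₃ (λ a b c → f (- a) (- b) (- c)) xs     ≡⟨ Σ₃-map -_ f xs ⟨
    Σ₃ f (map -_ xs)                          ≈⟨ Σ₃-cong≈ f-cong reverse-xs≈-xs ⟨
    Σ₃ f (reverse xs)                         ≡⟨ Σ₃-reverse f xs ⟩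
    Σ₃ (λ a b c → f c b a) xs                 ≡⟨ Σ₃-cong (λ a b c → reorder a b c) xs ⟩
    H₁₁₂ xs                                   ∎
    where
    open ≈-Reasoning
    f : ℚ → ℚ → ℚ → ℚ
    f a b c = a · a · (b · c)
    f-cong : ∀ {a a′ b b′ c c′} → a ≈ a′ → b ≈ b′ → c ≈ c′ → f a b c ≈ f a′ b′ c′
    f-cong a≈a′ b≈b′ c≈c′ = ·-cong (·-cong a≈a′ a≈a′) (·-cong b≈b′ c≈c′)
    even-in-signs : ∀ a b c → f a b c ≡ f (- a) (- b) (- c)
    even-in-signs = solve 3 (λ a b c → a :* a :* (b :* c) := (:- a) :* (:- a) :* ((:- b) :* (:- c))) refl
    reorder : ∀ a b c → f c b a ≡ a · (b · (c · c))
    reorder = solve 3 (λ a b c → c :* c :* (b :* a) := a :* (b :* (c :* c))) refl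

  P₁≈0 : P₁ xs ≈ 0ℚ
  P₁≈0 = powerSum≈0 {λ y → y} (λ a≈b → a≈b) (ℤ.+ 2 / 1) 1ℚ (integral p∤1) refl
    (solve 1 (λ y → y := con (ℤ.+ 2 / 1) :* (y :* con ½)) refl)

  P₂≈0 : ¬ p ∣ 3 → P₂ xs ≈ 0ℚ
  P₂≈0 p∤3 = powerSum≈0 {λ y → y · y} (λ a≈b → ·-cong a≈b a≈b)
    (ℤ.+ 4 / 1) (ℤ.+ 1 / 3) (integral-/ (ℤ.+ 1) 3 p∤3) refl
    (solve 1 (λ y → y :* y := con (ℤ.+ 4 / 1) :* ((y :* con ½) :* (y :* con ½))) refl)

  P₄≈0 : ¬ p ∣ 15 → P₄ xs ≈ 0ℚ
  P₄≈0 p∤15 = powerSum≈0 {λ y → y · y · (y · y)} (λ a≈b → ·-cong (·-cong a≈b a≈b) (·-cong a≈b a≈b))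
    (ℤ.+ 16 / 1) (ℤ.+ 1 / 15) (integral-/ (ℤ.+ 1) 15 p∤15) refl
    (solve 1 (λ y → y :* y :* (y :* y)
                := con (ℤ.+ 16 / 1) :* ((y :* con ½) :* (y :* con ½) :* ((y :* con ½) :* (y :* con ½)))) refl)

  H₁₁₂≈-½H₁₂₁ : 7 ≤ p → H₁₁₂ xs ≈ (- ½) · H₁₂₁ xs
  H₁₁₂≈-½H₁₂₁ 7≤p = begin
    B
      ≡⟨ isolate A B C ⟩
    ½ · ((A + C + B) - (A - B)) + (- ½) · C
      ≈⟨ +-cong (·-cong ½≈½ (+-cong A+C+B≈0 (-‿cong (x≈y⇒x-y≈0 H₂₁₁≈H₁₁₂)))) (·-cong (-‿cong ½≈½) C≈C) ⟩
    ½ · (0ℚ - 0ℚ) + (- ½) · C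
      ≡⟨ cleanup C ⟩
    (- ½) · C ∎
    where
    open ≈-Reasoning
    A = H₂₁₁ xs
    B = H₁₁₂ xs
    C = H₁₂₁ xs
    small-∤ : ∀ m .{{_ : NonZero m}} → {T (m <ᵇ 7)} → ¬ p ∣ m
    small-∤ m {m<ᵇ7} = >⇒∤ (ℕ.<-≤-trans (ℕ.<ᵇ⇒< m 7 m<ᵇ7) 7≤p)
    ½≈½ : ½ ≈ ½
    ½≈½ = ≈-refl (integral-/ (ℤ.+ 1) 2 (small-∤ 2))
    C≈C : C ≈ C
    C≈C = Σ₃-cong≈ (λ a≈a′ b≈b′ c≈c′ → ·-cong a≈a′ (·-cong (·-cong b≈b′ b≈b′) c≈c′)) xs≈xs
    A+C+B≈0 : A + C + B ≈ 0ℚ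
    A+C+B≈0 = begin
      A + C + B
        ≡⟨ H₂₁₁+H₁₂₁+H₁₁₂≡P₂E₂-P₃P₁+P₄ xs ⟩
      P₂ xs · E₂ xs - P₃ xs · P₁ xs + P₄ xs
        ≈⟨ +-cong (+-cong (·-cong (P₂≈0 (small-∤ 3)) E₂≈E₂) (-‿cong (·-cong P₃≈P₃ P₁≈0)))
                  (P₄≈0 (∤-* (small-∤ 3) (small-∤ 5))) ⟩
      0ℚ · E₂ xs - P₃ xs · 0ℚ + 0ℚ
        ≡⟨ annihilate (E₂ xs) (P₃ xs) ⟩
      0ℚ ∎
      where
      E₂≈E₂ = Σ₂-cong≈ ·-cong xs≈xs
      P₃≈P₃ = Σ₁-cong≈ (λ a≈a′ → ·-cong (·-cong a≈a′ a≈a′) a≈a′) xs≈xs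
      annihilate : ∀ e s → 0ℚ · e - s · 0ℚ + 0ℚ ≡ 0ℚ
      annihilate = solve 2 (λ e s → con 0ℚ :* e :- s :* con 0ℚ :+ con 0ℚ := con 0ℚ) refl
    isolate : ∀ a b c → b ≡ ½ · ((a + c + b) - (a - b)) + (- ½) · c
    isolate = solve 3 (λ a b c → b := con ½ :* ((a :+ c :+ b) :- (a :- b)) :+ con (- ½) :* c) refl
    cleanup : ∀ c → ½ · (0ℚ - 0ℚ) + (- ½) · c ≡ (- ½) · c
    cleanup = solve 1 (λ c → con ½ :* (con 0ℚ :- con 0ℚ) :+ con (- ½) :* c := con (- ½) :* c) refl

inv[i²jk] : ∀ i j k → inv (i ^ 2 * j * k) ≡ inv i · inv i · (inv j · inv k)
inv[i²jk] i j k rewrite inv-· (i ^ 2 * j) k | inv-· (i ^ 2) j | inv-² i = ℚ.*-assoc (inv i · inv i) (inv j) (inv k)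

inv[ij²k] : ∀ i j k → inv (i * j ^ 2 * k) ≡ inv i · (inv j · inv j · inv k)
inv[ij²k] i j k rewrite inv-· (i * j ^ 2) k | inv-· i (j ^ 2) | inv-² j = ℚ.*-assoc (inv i) (inv j · inv j) (inv k)

inv[ijk²] : ∀ i j k → inv (i * j * k ^ 2) ≡ inv i · (inv j · (inv k · inv k))
inv[ijk²] i j k rewrite inv-· (i * j) (k ^ 2) | inv-· i j | inv-² k = ℚ.*-assoc (inv i) (inv j) (inv k · inv k)

lemma2p7 : (p : ℕ) → Prime p → 7 ≤ p →
    (tripleSum p (λ i j k → inv (i ^ 2 * j * k))
      ≡ tripleSum p (λ i j k → inv (i * j * k ^ 2)) [modℚ p ])
    × (tripleSum p (λ i j k → inv (i * j * k ^ 2))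
      ≡ (- ½) *ℚ tripleSum p (λ i j k → inv (i * j ^ 2 * k)) [modℚ p ])
lemma2p7 p p-prime 7≤p with prime⇒odd p-prime (ℕ.≤-trans (ℕ.m≤m+n 3 4) 7≤p)
... | h , refl = ≈⇒≡[modℚ] (begin
      tripleSum p (λ i j k → inv (i ^ 2 * j * k))   ≡⟨ tripleSum≡Σ₃ p _ _ inv[i²jk] ⟩
      H₂₁₁ xs                                        ≈⟨ H₂₁₁≈H₁₁₂ ⟩
      H₁₁₂ xs                                        ≡⟨ tripleSum≡Σ₃ p _ _ inv[ijk²] ⟨
      tripleSum p (λ i j k → inv (i * j * k ^ 2))   ∎)
  , ≈⇒≡[modℚ] (begin
      tripleSum p (λ i j k → inv (i * j * k ^ 2))   ≡⟨ tripleSum≡Σ₃ p _ _ inv[ijk²] ⟩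
      H₁₁₂ xs                                        ≈⟨ H₁₁₂≈-½H₁₂₁ 7≤p ⟩
      (- ½) · H₁₂₁ xs                                ≡⟨ cong ((- ½) ·_) (tripleSum≡Σ₃ p _ _ inv[ij²k]) ⟨
      (- ½) · tripleSum p (λ i j k → inv (i * j ^ 2 * k)) ∎)
  where
  open OddPrime h p-prime
  open ≈-Reasoning
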